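{- Let $G=(V,E)$ be a connected graph with $n$ vertices, let $\tau$ be a set of types with $|\tau|=k>1$, let $f:\tau\to\mathbb{Q}_{\ge1}$ be a fitness function, and let $\alpha\in\tau_{\max}(f)$. Let $f^+=f(\alpha)$ and $f^*=\max\{f(j):j\in\tau\setminus\{\alpha\}\}$, and suppose $f^*<f^+$. Let $M_0\in\Omega_0(G,\tau)$. Then $\mathbb{E}(A_\alpha(G,\tau,f,M_0))\le\frac{f^+}{f^+-f^*}(n+1)n^3$.
   Context: $\tau_{\max}(f)=\{i:f(i)=\max_jf(j)\}$. $\Omega$ is the set of functions $V\to\tau$ and $\Omega_0(G,\tau)$ the set of $S\in\Omega$ whose range is all of $\tau$. For $S\in\Omega$, $S|_{v\to w}$ equals $S$ except that $w$ gets type $S(v)$. The Moran process $M(G,\tau,f,M_0)$ is the Markov chain on $\Omega$ started at $M_0$ in which, given $M_t$, a vertex $v$ is chosen with probability $f(M_t(v))/\sum_uf(M_t(u))$, then a uniformly random neighbour $w$ of $v$, and $M_{t+1}=M_t|_{v\to w}$. $V_j(t)=\{v: M_t(v)=j\}$. The absorption time of type $j$ is $A_j(G,\tau,f,M_0)=\min\{t\in\mathbb{Z}_{\ge0}: V_j(t)=V\text{ or }V_j(t)=\emptyset\}$. -}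

module Defs where

open import Data.Nat as ℕ using (ℕ; zero; suc)
open import Data.Integer as ℤ using (+_; +[1+_]; -[1+_])
open import Data.Rational using (ℚ; mkℚ; 0ℚ; 1ℚ; _+_; _*_; _/_; 1/_)
open import Data.Fin using (Fin; _≟_)
open import Data.List using (List; []; _∷_; foldr; map; filterᵇ; length)
open import Data.List using () renaming (allFin to allFinL)
open import Data.Bool using (Bool; true; false; if_then_else_; _∨_)
open import Relation.Nullary using (does)
open import Relation.Binary.PropositionalEquality using (_≡_)

record Graph (n : ℕ) : Set where
  field
    adj   : Fin n → Fin n → Bool
    sym   : ∀ u v → adj u v ≡ adj v u
    irrefl : ∀ v → adj v v ≡ false
open Graph public

data Reach {n : ℕ} (G : Graph n) : Fin n → Fin n → Set where
  here  : ∀ {v} → Reach G v v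
  there : ∀ {u v w} → adj G u v ≡ true → Reach G v w → Reach G u w

Connected : ∀ {n} → Graph n → Set
Connected G = ∀ u v → Reach G u v

neighbours : ∀ {n} → Graph n → Fin n → List (Fin n)
neighbours {n} G v = filterᵇ (adj G v) (allFinL n)

ℕtoℚ : ℕ → ℚ
ℕtoℚ m = (+ m) / 1

-- Inverse of a rational (only ever used on nonzero arguments; 0 ↦ 0).
inv : ℚ → ℚ
inv (mkℚ (+ zero) _ _) = 0ℚ
inv p@(mkℚ +[1+ _ ] _ _) = 1/ p
inv p@(mkℚ -[1+ _ ] _ _) = 1/ p

sumℚ : List ℚ → ℚ
sumℚ = foldr _+_ 0ℚ

Config : ℕ → ℕ → Set
Config n k = Fin n → Fin k

update : ∀ {n k} → Config n k → Fin n → Fin n → Config n k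
update S v w u = if does (u ≟ w) then S v else S u

absorbed : ∀ {n k} → Fin k → Config n k → Bool
absorbed {n} α S =
  let c = length (filterᵇ (λ u → does (S u ≟ α)) (allFinL n)) in
  does (c ℕ.≟ 0) ∨ does (c ℕ.≟ n)

-- expTrunc G f α T S  =  E[ min(A_α(G,τ,f,S), T) ]  for the Moran process
-- M(G,τ,f,S), computed by first-step analysis: 0 if S is already absorbed
-- for α, else 1 + Σ_{v,w∈N(v)} P(step v→w) · E[min(A_α, T-1)] from S|_{v→w},
-- where P(step v→w) = f(S v)/(Σ_u f(S u)) · 1/deg(v).
expTrunc : ∀ {n k} → Graph n → (Fin k → ℚ) → Fin k → ℕ → Config n k → ℚ
expTrunc G f α zero S = 0ℚ
expTrunc {n} G f α (suc T) S =
  if absorbed α S then 0ℚ else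
  (1ℚ + sumℚ (map (λ v →
          sumℚ (map (λ w →
                  f (S v) * inv W * inv (ℕtoℚ (length (neighbours G v)))
                    * expTrunc G f α T (update S v w))
                (neighbours G v)))
        (allFinL n)))
  where
  W : ℚ
  W = sumℚ (map (λ u → f (S u)) (allFinL n))

{-# OPTIONS --safe #-}
-- Let φ(S) = Σ_{u : S u = α} 1/deg u, so 0 ≤ φ ≤ n. Pairing the two
-- orientations of each edge vw, the expected one-step change of φ is
--   Σ_{vw ∈ E} (f(S v) − f(S w)) (χ v − χ w) / (W · deg v · deg w),   W = Σ_u f(S u),  χ = 1_{V_α},
-- a sum of nonnegative terms because α is the fittest type. While α is neither extinct nor fixed,
-- connectivity gives an edge from V_α to its complement, whose term is at least (f⁺ − f*) / (n f⁺ · n²).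
-- Hence B(S) = (n + 1 − φ(S)) · f⁺ n³ / (f⁺ − f*) is nonnegative and drops by at least 1 in expectation
-- at every step before absorption, so it bounds the expected absorption time truncated at any T;
-- finally B ≤ (n + 1) n³ f⁺ / (f⁺ − f*).
module Submission where

open import Defs
open import Data.Nat using (ℕ; _^_) renaming (_<_ to _<ℕ_; suc to sucℕ; _*_ to _*ℕ_)
open import Data.Fin using (Fin)
open import Data.Rational using (ℚ; 1ℚ; _≤_; _<_; _*_; _-_)
open import Data.Product using (Σ; _×_; ∃)
open import Relation.Binary.PropositionalEquality using (_≡_; _≢_)

open import Level using (0ℓ)
open import Function using (_∘_; id)
open import Data.Empty using (⊥-elim)
open import Data.Bool using (true; false; if_then_else_; T)
open import Data.Bool.Properties using (∨-conicalˡ; ∨-conicalʳ)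
import Data.Integer as ℤ
import Data.Integer.Properties as ℤ
import Data.Nat as ℕ
import Data.Nat.Properties as ℕₚ
open import Data.Nat.Coprimality using (1-coprimeTo)
import Data.Nat.Coprimality as Coprime
open import Data.Fin using (zero; suc; _≟_)
open import Data.List using (List; []; _∷_; map; filterᵇ; length; allFin)
open import Data.List.Properties using (map-tabulate; length-tabulate; length-filter; filter-some)
open import Data.List.Membership.Propositional using (lose)
open import Data.List.Membership.Propositional.Properties using (∈-allFin)
open import Data.Product using (_,_; ∃₂)
open import Data.Rational using (mkℚ; 0ℚ; _+_; -_; _/_; 1/_; nonNegative)
open import Data.Rational.Properties hiding (_≟_)
import Data.Rational.Properties as ℚ
open import Data.Unit using (tt)
open import Relation.Binary.PropositionalEquality as ≡ using (refl; cong; cong₂; trans; subst; module ≡-Reasoning)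
open import Relation.Nullary using (¬_; Dec; does; yes; no; contradiction)
open import Relation.Nullary.Decidable using (T?; dec-true; dec-false; dec⇒maybe)
open import Relation.Unary using (Decidable)
open import Tactic.RingSolver using (solve-∀)
open import Tactic.RingSolver.Core.AlmostCommutativeRing using (AlmostCommutativeRing; fromCommutativeRing)

ℚ-ring : AlmostCommutativeRing 0ℓ 0ℓ
ℚ-ring = fromCommutativeRing +-*-commutativeRing (λ p → dec⇒maybe (0ℚ ℚ.≟ p))

0≤1 : 0ℚ ≤ 1ℚ
0≤1 = nonNegative⁻¹ 1ℚ

0<1 : 0ℚ < 1ℚ
0<1 = positive⁻¹ 1ℚ

p≤q⇒0≤q-p : ∀ {p q} → p ≤ q → 0ℚ ≤ q - p
p≤q⇒0≤q-p {p} {q} p≤q = subst (_≤ q - p) (+-inverseʳ p) (+-monoˡ-≤ (- p) p≤q)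

p<q⇒0<q-p : ∀ {p q} → p < q → 0ℚ < q - p
p<q⇒0<q-p {p} {q} p<q = subst (_< q - p) (+-inverseʳ p) (+-monoˡ-< (- p) p<q)

p+p≤q+q⇒p≤q : ∀ {p q} → p + p ≤ q + q → p ≤ q
p+p≤q+q⇒p≤q p+p≤q+q = ≮⇒≥ (λ q<p → <-irrefl refl (<-≤-trans (+-mono-< q<p q<p) p+p≤q+q))

*-nonNeg : ∀ {p q} → 0ℚ ≤ p → 0ℚ ≤ q → 0ℚ ≤ p * q
*-nonNeg {p} {q} 0≤p 0≤q =
  nonNegative⁻¹ (p * q) {{nonNeg*nonNeg⇒nonNeg p {{nonNegative 0≤p}} q {{nonNegative 0≤q}}}}

*-monoˡ-≤-0≤ : ∀ {r p q} → 0ℚ ≤ r → p ≤ q → r * p ≤ r * q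
*-monoˡ-≤-0≤ {r} 0≤r = *-monoˡ-≤-nonNeg r {{nonNegative 0≤r}}

*-monoʳ-≤-0≤ : ∀ {r p q} → 0ℚ ≤ r → p ≤ q → p * r ≤ q * r
*-monoʳ-≤-0≤ {r} 0≤r = *-monoʳ-≤-nonNeg r {{nonNegative 0≤r}}

*-mono-≤-0≤ : ∀ {p p′ q q′} → 0ℚ ≤ p → 0ℚ ≤ q → p ≤ p′ → q ≤ q′ → p * q ≤ p′ * q′
*-mono-≤-0≤ 0≤p 0≤q p≤p′ q≤q′ =
  ≤-trans (*-monoʳ-≤-0≤ 0≤q p≤p′) (*-monoˡ-≤-0≤ (≤-trans 0≤p p≤p′) q≤q′)

if-nonNeg : ∀ b {p} → 0ℚ ≤ p → 0ℚ ≤ (if b then p else 0ℚ)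
if-nonNeg true  0≤p = 0≤p
if-nonNeg false _   = ≤-refl

if-*ʳ : ∀ b p q → (if b then p * q else 0ℚ) ≡ (if b then p else 0ℚ) * q
if-*ʳ true  p q = refl
if-*ʳ false p q = ≡.sym (*-zeroˡ q)

if-≤ : ∀ b {p q r} → (b ≡ true → p ≤ r) → (b ≡ false → q ≤ r) → (if b then p else q) ≤ r
if-≤ true  p≤r _   = p≤r refl
if-≤ false _   q≤r = q≤r refl

ℕtoℚ-suc : ∀ m → ℕtoℚ (ℕ.suc m) ≡ 1ℚ + ℕtoℚ m
ℕtoℚ-suc m rewrite normalize-coprime (Coprime.sym (1-coprimeTo m)) =
  cong (_/ 1) (≡.sym (cong (ℤ._+_ (ℤ.+ 1)) (ℤ.*-identityʳ (ℤ.+ m))))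

ℕtoℚ-+ : ∀ a b → ℕtoℚ (a ℕ.+ b) ≡ ℕtoℚ a + ℕtoℚ b
ℕtoℚ-+ ℕ.zero b = ≡.sym (+-identityˡ (ℕtoℚ b))
ℕtoℚ-+ (ℕ.suc a) b = begin
  ℕtoℚ (ℕ.suc (a ℕ.+ b))     ≡⟨ ℕtoℚ-suc (a ℕ.+ b) ⟩
  1ℚ + ℕtoℚ (a ℕ.+ b)        ≡⟨ cong (1ℚ +_) (ℕtoℚ-+ a b) ⟩
  1ℚ + (ℕtoℚ a + ℕtoℚ b)     ≡⟨ ≡.sym (+-assoc 1ℚ (ℕtoℚ a) (ℕtoℚ b)) ⟩
  1ℚ + ℕtoℚ a + ℕtoℚ b       ≡⟨ cong (_+ ℕtoℚ b) (≡.sym (ℕtoℚ-suc a)) ⟩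
  ℕtoℚ (ℕ.suc a) + ℕtoℚ b    ∎
  where open ≡-Reasoning

ℕtoℚ-* : ∀ a b → ℕtoℚ (a ℕ.* b) ≡ ℕtoℚ a * ℕtoℚ b
ℕtoℚ-* ℕ.zero b = ≡.sym (*-zeroˡ (ℕtoℚ b))
ℕtoℚ-* (ℕ.suc a) b = begin
  ℕtoℚ (b ℕ.+ a ℕ.* b)        ≡⟨ ℕtoℚ-+ b (a ℕ.* b) ⟩
  ℕtoℚ b + ℕtoℚ (a ℕ.* b)     ≡⟨ cong (ℕtoℚ b +_) (ℕtoℚ-* a b) ⟩
  ℕtoℚ b + ℕtoℚ a * ℕtoℚ b    ≡⟨ distrib (ℕtoℚ a) (ℕtoℚ b) ⟩
  (1ℚ + ℕtoℚ a) * ℕtoℚ b      ≡⟨ cong (_* ℕtoℚ b) (≡.sym (ℕtoℚ-suc a)) ⟩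
  ℕtoℚ (ℕ.suc a) * ℕtoℚ b     ∎
  where
  open ≡-Reasoning
  distrib : ∀ x y → y + x * y ≡ (1ℚ + x) * y
  distrib = solve-∀ ℚ-ring

ℕtoℚ-nonNeg : ∀ m → 0ℚ ≤ ℕtoℚ m
ℕtoℚ-nonNeg m = nonNegative⁻¹ (ℕtoℚ m) {{normalize-nonNeg m 1}}

ℕtoℚ-mono-≤ : ∀ {a b} → a ℕ.≤ b → ℕtoℚ a ≤ ℕtoℚ b
ℕtoℚ-mono-≤ {a} {b} a≤b = begin
  ℕtoℚ a                          ≡⟨ ≡.sym (+-identityʳ (ℕtoℚ a)) ⟩
  ℕtoℚ a + 0ℚ                     ≤⟨ +-monoʳ-≤ (ℕtoℚ a) (ℕtoℚ-nonNeg (b ℕ.∸ a)) ⟩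
  ℕtoℚ a + ℕtoℚ (b ℕ.∸ a)         ≡⟨ ≡.sym (ℕtoℚ-+ a (b ℕ.∸ a)) ⟩
  ℕtoℚ (a ℕ.+ (b ℕ.∸ a))          ≡⟨ cong ℕtoℚ (ℕₚ.m+[n∸m]≡n a≤b) ⟩
  ℕtoℚ b                          ∎
  where open ≤-Reasoning

inv-nonNeg : ∀ {p} → 0ℚ ≤ p → 0ℚ ≤ inv p
inv-nonNeg {mkℚ (ℤ.+ 0) _ _} _ = ≤-refl
inv-nonNeg {p@(mkℚ ℤ.+[1+ _ ] _ _)} _ = nonNegative⁻¹ (1/ p) {{pos⇒nonNeg (1/ p) {{1/pos⇒pos p}}}}
inv-nonNeg {p@(mkℚ ℤ.-[1+ _ ] _ _)} 0≤p = ⊥-elim (<-irrefl refl (<-≤-trans (negative⁻¹ p) 0≤p))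

-- Since `inv 0ℚ = 0ℚ`, `p * inv p` is 1 only for positive `p`; for `0 ≤ p` it is merely at most 1.
*-inv≤1 : ∀ {p} → 0ℚ ≤ p → p * inv p ≤ 1ℚ
*-inv≤1 {p@(mkℚ (ℤ.+ 0) _ _)} _ = ≤-trans (≤-reflexive (*-zeroʳ p)) 0≤1
*-inv≤1 {p@(mkℚ ℤ.+[1+ _ ] _ _)} _ = ≤-reflexive (*-inverseʳ p)
*-inv≤1 {p@(mkℚ ℤ.-[1+ _ ] _ _)} 0≤p = ⊥-elim (<-irrefl refl (<-≤-trans (negative⁻¹ p) 0≤p))

*-inv≡1 : ∀ {p} → 0ℚ < p → p * inv p ≡ 1ℚ
*-inv≡1 {p@(mkℚ (ℤ.+ 0) _ _)} 0<p = ⊥-elim (<-irrefl (≡.sym (↥p≡0⇒p≡0 p refl)) 0<p)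
*-inv≡1 {p@(mkℚ ℤ.+[1+ _ ] _ _)} _ = *-inverseʳ p
*-inv≡1 {p@(mkℚ ℤ.-[1+ _ ] _ _)} 0<p = ⊥-elim (<-asym 0<p (negative⁻¹ p))

inv-antimono-≤ : ∀ {p q} → 0ℚ < p → p ≤ q → inv q ≤ inv p
inv-antimono-≤ {p} {q} 0<p p≤q = begin
  inv q                   ≡⟨ ≡.sym (*-identityʳ (inv q)) ⟩
  inv q * 1ℚ              ≡⟨ cong (inv q *_) (≡.sym (*-inv≡1 0<p)) ⟩
  inv q * (p * inv p)     ≤⟨ *-monoˡ-≤-0≤ (inv-nonNeg 0≤q) (*-monoʳ-≤-0≤ (inv-nonNeg (<⇒≤ 0<p)) p≤q) ⟩
  inv q * (q * inv p)     ≡⟨ reassoc (inv q) q (inv p) ⟩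
  (q * inv q) * inv p     ≡⟨ cong (_* inv p) (*-inv≡1 (<-≤-trans 0<p p≤q)) ⟩
  1ℚ * inv p              ≡⟨ *-identityˡ (inv p) ⟩
  inv p                   ∎
  where
  open ≤-Reasoning
  0≤q : 0ℚ ≤ q
  0≤q = ≤-trans (<⇒≤ 0<p) p≤q
  reassoc : ∀ x y z → x * (y * z) ≡ (y * x) * z
  reassoc = solve-∀ ℚ-ring

inv-ℕtoℚ≤1 : ∀ m → inv (ℕtoℚ m) ≤ 1ℚ
inv-ℕtoℚ≤1 ℕ.zero = 0≤1
inv-ℕtoℚ≤1 (ℕ.suc m) = inv-antimono-≤ 0<1 (ℕtoℚ-mono-≤ {1} {ℕ.suc m} (ℕ.s≤s ℕ.z≤n))

∑ : {A : Set} → List A → (A → ℚ) → ℚ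
∑ xs g = sumℚ (map g xs)

syntax ∑ xs (λ x → e) = ∑[ x ∈ xs ] e

module _ {A : Set} where

  ∑-cong : ∀ (xs : List A) {g h} → (∀ x → g x ≡ h x) → ∑ xs g ≡ ∑ xs h
  ∑-cong []       g≡h = refl
  ∑-cong (x ∷ xs) g≡h = cong₂ _+_ (g≡h x) (∑-cong xs g≡h)

  ∑-mono-≤ : ∀ (xs : List A) {g h} → (∀ x → g x ≤ h x) → ∑ xs g ≤ ∑ xs h
  ∑-mono-≤ []       g≤h = ≤-refl
  ∑-mono-≤ (x ∷ xs) g≤h = +-mono-≤ (g≤h x) (∑-mono-≤ xs g≤h)

  ∑-zero : ∀ (xs : List A) → ∑[ _ ∈ xs ] 0ℚ ≡ 0ℚ
  ∑-zero []       = refl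
  ∑-zero (x ∷ xs) = trans (+-identityˡ _) (∑-zero xs)

  ∑-nonNeg : ∀ (xs : List A) {g} → (∀ x → 0ℚ ≤ g x) → 0ℚ ≤ ∑ xs g
  ∑-nonNeg xs {g} 0≤g = subst (_≤ ∑ xs g) (∑-zero xs) (∑-mono-≤ xs 0≤g)

  ∑-distrib-+ : ∀ (xs : List A) g h → ∑[ x ∈ xs ] (g x + h x) ≡ ∑ xs g + ∑ xs h
  ∑-distrib-+ []       g h = refl
  ∑-distrib-+ (x ∷ xs) g h =
    trans (cong (g x + h x +_) (∑-distrib-+ xs g h)) (interchange (g x) (h x) (∑ xs g) (∑ xs h))
    where
    interchange : ∀ a b c d → a + b + (c + d) ≡ a + c + (b + d)
    interchange = solve-∀ ℚ-ring

  ∑-distrib-- : ∀ (xs : List A) g h → ∑[ x ∈ xs ] (g x - h x) ≡ ∑ xs g - ∑ xs h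
  ∑-distrib-- []       g h = refl
  ∑-distrib-- (x ∷ xs) g h =
    trans (cong (g x - h x +_) (∑-distrib-- xs g h)) (interchange (g x) (h x) (∑ xs g) (∑ xs h))
    where
    interchange : ∀ a b c d → a - b + (c - d) ≡ a + c - (b + d)
    interchange = solve-∀ ℚ-ring

  ∑-*ˡ : ∀ (xs : List A) c g → ∑[ x ∈ xs ] (c * g x) ≡ c * ∑ xs g
  ∑-*ˡ []       c g = ≡.sym (*-zeroʳ c)
  ∑-*ˡ (x ∷ xs) c g = trans (cong (c * g x +_) (∑-*ˡ xs c g)) (≡.sym (*-distribˡ-+ c (g x) (∑ xs g)))

  ∑-const : ∀ (xs : List A) c → ∑[ _ ∈ xs ] c ≡ c * ℕtoℚ (length xs)
  ∑-const []       c = ≡.sym (*-zeroʳ c)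
  ∑-const (x ∷ xs) c = begin
    c + ∑[ _ ∈ xs ] c                 ≡⟨ cong (c +_) (∑-const xs c) ⟩
    c + c * ℕtoℚ (length xs)          ≡⟨ distrib c (ℕtoℚ (length xs)) ⟩
    c * (1ℚ + ℕtoℚ (length xs))       ≡⟨ cong (c *_) (≡.sym (ℕtoℚ-suc (length xs))) ⟩
    c * ℕtoℚ (ℕ.suc (length xs))      ∎
    where
    open ≡-Reasoning
    distrib : ∀ c l → c + c * l ≡ c * (1ℚ + l)
    distrib = solve-∀ ℚ-ring

  ∑-filterᵇ : ∀ (xs : List A) p g → ∑ (filterᵇ p xs) g ≡ ∑[ x ∈ xs ] (if p x then g x else 0ℚ)
  ∑-filterᵇ []       p g = refl
  ∑-filterᵇ (x ∷ xs) p g with p x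
  ... | true  = cong (g x +_) (∑-filterᵇ xs p g)
  ... | false = trans (∑-filterᵇ xs p g) (≡.sym (+-identityˡ _))

∑-comm : ∀ {A B : Set} (xs : List A) (ys : List B) (h : A → B → ℚ) →
         ∑[ x ∈ xs ] ∑[ y ∈ ys ] h x y ≡ ∑[ y ∈ ys ] ∑[ x ∈ xs ] h x y
∑-comm []       ys h = ≡.sym (∑-zero ys)
∑-comm (x ∷ xs) ys h = trans (cong (∑ ys (h x) +_) (∑-comm xs ys h))
                             (≡.sym (∑-distrib-+ ys (h x) (λ y → ∑[ x ∈ xs ] h x y)))

∑-allFin-suc : ∀ n (g : Fin (ℕ.suc n) → ℚ) → ∑ (allFin (ℕ.suc n)) g ≡ g zero + ∑ (allFin n) (g ∘ suc)
∑-allFin-suc n g =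
  cong (λ xs → g zero + sumℚ xs) (trans (map-tabulate suc g) (≡.sym (map-tabulate id (g ∘ suc))))

length-allFin : ∀ n → length (allFin n) ≡ n
length-allFin n = length-tabulate id

∑-allFin-const : ∀ n c → ∑[ _ ∈ allFin n ] c ≡ c * ℕtoℚ n
∑-allFin-const n c = trans (∑-const (allFin n) c) (cong (λ m → c * ℕtoℚ m) (length-allFin n))

∑-indicator : ∀ {n} (w : Fin n) c → ∑[ u ∈ allFin n ] (if does (u ≟ w) then c else 0ℚ) ≡ c
∑-indicator {ℕ.suc n} zero c = begin
  ∑[ u ∈ allFin (ℕ.suc n) ] (if does (u ≟ zero) then c else 0ℚ)
    ≡⟨ ∑-allFin-suc n (λ u → if does (u ≟ zero) then c else 0ℚ) ⟩
  c + ∑[ _ ∈ allFin n ] 0ℚ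
    ≡⟨ cong (c +_) (∑-zero (allFin n)) ⟩
  c + 0ℚ
    ≡⟨ +-identityʳ c ⟩
  c ∎
  where open ≡-Reasoning
∑-indicator {ℕ.suc n} (suc w) c =
  trans (∑-allFin-suc n (λ u → if does (u ≟ suc w) then c else 0ℚ)) (trans (+-identityˡ _) (∑-indicator w c))

term≤∑ : ∀ {n} {g : Fin n → ℚ} → (∀ i → 0ℚ ≤ g i) → ∀ a → g a ≤ ∑ (allFin n) g
term≤∑ {n} {g} 0≤g a = subst (_≤ ∑ (allFin n) g) (∑-indicator a (g a)) (∑-mono-≤ (allFin n) pick)
  where
  pick : ∀ i → (if does (i ≟ a) then g a else 0ℚ) ≤ g i
  pick i with i ≟ a
  ... | yes refl = ≤-refl
  ... | no _     = 0≤g i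

two-terms≤∑ : ∀ {n} {g : Fin n → ℚ} → (∀ i → 0ℚ ≤ g i) → ∀ {a b} → a ≢ b → g a + g b ≤ ∑ (allFin n) g
two-terms≤∑ {n} {g} 0≤g {a} {b} a≢b = subst (_≤ ∑ (allFin n) g) indicators (∑-mono-≤ (allFin n) pick)
  where
  δ : Fin n → Fin n → ℚ
  δ c i = if does (i ≟ c) then g c else 0ℚ
  indicators : ∑[ i ∈ allFin n ] (δ a i + δ b i) ≡ g a + g b
  indicators = trans (∑-distrib-+ (allFin n) (δ a) (δ b)) (cong₂ _+_ (∑-indicator a (g a)) (∑-indicator b (g b)))
  pick : ∀ i → δ a i + δ b i ≤ g i
  pick i with i ≟ a | i ≟ b
  ... | yes refl | yes refl = contradiction refl a≢b
  ... | yes refl | no _     = ≤-reflexive (+-identityʳ (g i))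
  ... | no _     | yes refl = ≤-reflexive (+-identityˡ (g i))
  ... | no _     | no _     = subst (_≤ g i) (≡.sym (+-identityˡ 0ℚ)) (0≤g i)

module _ {A : Set} {P : A → Set} (P? : Decidable P) where

  length-filterᵇ≢0⇒∃ : ∀ xs → length (filterᵇ (does ∘ P?) xs) ≢ 0 → ∃ P
  length-filterᵇ≢0⇒∃ []       ≢0 = contradiction refl ≢0
  length-filterᵇ≢0⇒∃ (x ∷ xs) ≢0 with P? x
  ... | yes px = x , px
  ... | no  _  = length-filterᵇ≢0⇒∃ xs ≢0

  length-filterᵇ≢length⇒∃¬ : ∀ xs → length (filterᵇ (does ∘ P?) xs) ≢ length xs → ∃ (¬_ ∘ P)
  length-filterᵇ≢length⇒∃¬ []       ≢len = contradiction refl ≢len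
  length-filterᵇ≢length⇒∃¬ (x ∷ xs) ≢len with P? x
  ... | yes _  = length-filterᵇ≢length⇒∃¬ xs (≢len ∘ cong ℕ.suc)
  ... | no ¬px = x , ¬px

does≡false⇒¬ : ∀ {P : Set} (P? : Dec P) → does P? ≡ false → ¬ P
does≡false⇒¬ P? ≡false p with () ← trans (≡.sym (dec-true P? p)) ≡false

¬absorbed⇒mixed : ∀ {n k} (α : Fin k) (S : Config n k) → absorbed α S ≡ false →
                  (∃ λ u → S u ≡ α) × (∃ λ u → S u ≢ α)
¬absorbed⇒mixed {n} α S ¬abs =
  length-filterᵇ≢0⇒∃ isα? (allFin n) count≢0 , length-filterᵇ≢length⇒∃¬ isα? (allFin n) count≢n
  where
  isα? : Decidable (λ u → S u ≡ α)
  isα? u = S u ≟ α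
  count : ℕ
  count = length (filterᵇ (does ∘ isα?) (allFin n))
  count≢0 : count ≢ 0
  count≢0 = does≡false⇒¬ (count ℕ.≟ 0) (∨-conicalˡ _ _ ¬abs)
  count≢n : count ≢ length (allFin n)
  count≢n c≡len = does≡false⇒¬ (count ℕ.≟ n) (∨-conicalʳ _ _ ¬abs) (trans c≡len (length-allFin n))

module _ {n} (G : Graph n) where

  crossing-edge : ∀ {P : Fin n → Set} → Decidable P → ∀ {u v} → Reach G u v → P u → ¬ P v →
                  ∃₂ λ x y → adj G x y ≡ true × P x × ¬ P y
  crossing-edge P? here pu ¬pv = contradiction pu ¬pv
  crossing-edge P? (there {u} {w} u~w r) pu ¬pv with P? w
  ... | yes pw  = crossing-edge P? r pw ¬pv
  ... | no  ¬pw = u , w , u~w , pu , ¬pw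

  ¬absorbed⇒crossing-edge : Connected G → ∀ {k} (α : Fin k) (S : Config n k) → absorbed α S ≡ false →
                            ∃₂ λ x y → adj G x y ≡ true × S x ≡ α × S y ≢ α
  ¬absorbed⇒crossing-edge conn α S ¬abs =
    let ((u , Su≡α) , (u′ , Su′≢α)) = ¬absorbed⇒mixed α S ¬abs
    in crossing-edge (λ x → S x ≟ α) (conn u u′) Su≡α Su′≢α

  deg : Fin n → ℚ
  deg v = ℕtoℚ (length (neighbours G v))

  deg-nonNeg : ∀ v → 0ℚ ≤ deg v
  deg-nonNeg v = ℕtoℚ-nonNeg (length (neighbours G v))

  deg≤n : ∀ v → deg v ≤ ℕtoℚ n
  deg≤n v = ℕtoℚ-mono-≤ (subst (length (neighbours G v) ℕ.≤_) (length-allFin n)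
                                (length-filter (T? ∘ adj G v) (allFin n)))

  1≤deg : ∀ {v w} → adj G v w ≡ true → 1ℚ ≤ deg v
  1≤deg {v} {w} v~w =
    ℕtoℚ-mono-≤ (filter-some (T? ∘ adj G v) (lose (∈-allFin w) (subst T (≡.sym v~w) tt)))

module Potential {n k : ℕ} (G : Graph n) (f : Fin k → ℚ) (α : Fin k)
                 (f≥1 : ∀ i → 1ℚ ≤ f i) (f≤fα : ∀ i → f i ≤ f α) where

  V : List (Fin n)
  V = allFin n

  ∑ₑ : (Fin n → Fin n → ℚ) → ℚ
  ∑ₑ g = ∑[ v ∈ V ] ∑[ w ∈ neighbours G v ] g v w

  ∑² : (Fin n → Fin n → ℚ) → ℚ
  ∑² g = ∑[ v ∈ V ] ∑[ w ∈ V ] g v w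

  ∑ₑ-mono-≤ : ∀ {g h} → (∀ v w → g v w ≤ h v w) → ∑ₑ g ≤ ∑ₑ h
  ∑ₑ-mono-≤ g≤h = ∑-mono-≤ V (λ v → ∑-mono-≤ (neighbours G v) (g≤h v))

  ∑ₑ-cong : ∀ {g h} → (∀ v w → g v w ≡ h v w) → ∑ₑ g ≡ ∑ₑ h
  ∑ₑ-cong g≡h = ∑-cong V (λ v → ∑-cong (neighbours G v) (g≡h v))

  ∑ₑ-linear : ∀ a b g h → ∑ₑ (λ v w → a * g v w - b * h v w) ≡ a * ∑ₑ g - b * ∑ₑ h
  ∑ₑ-linear a b g h = trans
    (∑-cong V λ v → trans (∑-distrib-- (neighbours G v) (λ w → a * g v w) (λ w → b * h v w))
                          (cong₂ _-_ (∑-*ˡ (neighbours G v) a (g v)) (∑-*ˡ (neighbours G v) b (h v))))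
    (trans (∑-distrib-- V (λ v → a * ∑ (neighbours G v) (g v)) (λ v → b * ∑ (neighbours G v) (h v)))
           (cong₂ _-_ (∑-*ˡ V a (λ v → ∑ (neighbours G v) (g v))) (∑-*ˡ V b (λ v → ∑ (neighbours G v) (h v)))))

  ∑²-cong : ∀ {g h} → (∀ v w → g v w ≡ h v w) → ∑² g ≡ ∑² h
  ∑²-cong g≡h = ∑-cong V (λ v → ∑-cong V (g≡h v))

  ∑²-distrib-+ : ∀ g h → ∑² (λ v w → g v w + h v w) ≡ ∑² g + ∑² h
  ∑²-distrib-+ g h = trans (∑-cong V (λ v → ∑-distrib-+ V (g v) (h v)))
                           (∑-distrib-+ V (λ v → ∑ V (g v)) (λ v → ∑ V (h v)))

  χ : Config n k → Fin n → ℚ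
  χ S u = if does (S u ≟ α) then 1ℚ else 0ℚ

  φ : Config n k → ℚ
  φ S = ∑[ u ∈ V ] (χ S u * inv (deg G u))

  W : Config n k → ℚ
  W S = ∑[ u ∈ V ] f (S u)

  stepProb : Config n k → Fin n → ℚ
  stepProb S v = f (S v) * inv (W S) * inv (deg G v)

  drift : Config n k → ℚ
  drift S = ∑ₑ λ v w → stepProb S v * (φ (update S v w) - φ S)

  edgeRate : Config n k → Fin n → Fin n → ℚ
  edgeRate S v w = if adj G v w then inv (W S) * (inv (deg G v) * inv (deg G w)) else 0ℚ

  pairDrift : Config n k → Fin n → Fin n → ℚ
  pairDrift S v w = edgeRate S v w * ((f (S v) - f (S w)) * (χ S v - χ S w))

  f-nonNeg : ∀ i → 0ℚ ≤ f i
  f-nonNeg i = ≤-trans 0≤1 (f≥1 i)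

  inv-deg-nonNeg : ∀ v → 0ℚ ≤ inv (deg G v)
  inv-deg-nonNeg v = inv-nonNeg (deg-nonNeg G v)

  χ-nonNeg : ∀ S u → 0ℚ ≤ χ S u
  χ-nonNeg S u with S u ≟ α
  ... | yes _ = 0≤1
  ... | no  _ = ≤-refl

  χ≤1 : ∀ S u → χ S u ≤ 1ℚ
  χ≤1 S u with S u ≟ α
  ... | yes _ = ≤-refl
  ... | no  _ = 0≤1

  χ-α : ∀ {S u} → S u ≡ α → χ S u ≡ 1ℚ
  χ-α {S} {u} Su≡α = cong (λ b → if b then 1ℚ else 0ℚ) (dec-true (S u ≟ α) Su≡α)

  χ-≢α : ∀ {S u} → S u ≢ α → χ S u ≡ 0ℚ
  χ-≢α {S} {u} Su≢α = cong (λ b → if b then 1ℚ else 0ℚ) (dec-false (S u ≟ α) Su≢α)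

  φ-nonNeg : ∀ S → 0ℚ ≤ φ S
  φ-nonNeg S = ∑-nonNeg V (λ u → *-nonNeg (χ-nonNeg S u) (inv-deg-nonNeg u))

  φ≤n : ∀ S → φ S ≤ ℕtoℚ n
  φ≤n S = begin
    φ S               ≤⟨ ∑-mono-≤ V term≤1 ⟩
    ∑[ _ ∈ V ] 1ℚ     ≡⟨ ∑-allFin-const n 1ℚ ⟩
    1ℚ * ℕtoℚ n       ≡⟨ *-identityˡ (ℕtoℚ n) ⟩
    ℕtoℚ n            ∎
    where
    open ≤-Reasoning
    term≤1 : ∀ u → χ S u * inv (deg G u) ≤ 1ℚ
    term≤1 u = ≤-trans (*-mono-≤-0≤ (χ-nonNeg S u) (inv-deg-nonNeg u) (χ≤1 S u) (inv-ℕtoℚ≤1 (length (neighbours G u))))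
                       (≤-reflexive (*-identityˡ 1ℚ))

  W-nonNeg : ∀ S → 0ℚ ≤ W S
  W-nonNeg S = ∑-nonNeg V (λ u → f-nonNeg (S u))

  W≤n*fα : ∀ S → W S ≤ ℕtoℚ n * f α
  W≤n*fα S = begin
    W S              ≤⟨ ∑-mono-≤ V (λ u → f≤fα (S u)) ⟩
    ∑[ _ ∈ V ] f α   ≡⟨ ∑-allFin-const n (f α) ⟩
    f α * ℕtoℚ n     ≡⟨ *-comm (f α) (ℕtoℚ n) ⟩
    ℕtoℚ n * f α     ∎
    where open ≤-Reasoning

  stepProb-nonNeg : ∀ S v → 0ℚ ≤ stepProb S v
  stepProb-nonNeg S v = *-nonNeg (*-nonNeg (f-nonNeg (S v)) (inv-nonNeg (W-nonNeg S))) (inv-deg-nonNeg v)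

  ∑ₑ-stepProb≤1 : ∀ S → ∑ₑ (λ v _ → stepProb S v) ≤ 1ℚ
  ∑ₑ-stepProb≤1 S = begin
    ∑ₑ (λ v _ → stepProb S v)             ≡⟨ ∑-cong V (λ v → ∑-const (neighbours G v) (stepProb S v)) ⟩
    ∑[ v ∈ V ] (stepProb S v * deg G v)   ≤⟨ ∑-mono-≤ V vertex≤ ⟩
    ∑[ v ∈ V ] (inv (W S) * f (S v))      ≡⟨ ∑-*ˡ V (inv (W S)) (f ∘ S) ⟩
    inv (W S) * W S                       ≡⟨ *-comm (inv (W S)) (W S) ⟩
    W S * inv (W S)                       ≤⟨ *-inv≤1 (W-nonNeg S) ⟩
    1ℚ                                    ∎
    where
    open ≤-Reasoning
    rearrange : ∀ x i j d → x * i * j * d ≡ (i * x) * (d * j)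
    rearrange = solve-∀ ℚ-ring
    vertex≤ : ∀ v → stepProb S v * deg G v ≤ inv (W S) * f (S v)
    vertex≤ v = begin
      stepProb S v * deg G v                            ≡⟨ rearrange (f (S v)) (inv (W S)) (inv (deg G v)) (deg G v) ⟩
      (inv (W S) * f (S v)) * (deg G v * inv (deg G v)) ≤⟨ *-monoˡ-≤-0≤ (*-nonNeg (inv-nonNeg (W-nonNeg S)) (f-nonNeg (S v)))
                                                                         (*-inv≤1 (deg-nonNeg G v)) ⟩
      (inv (W S) * f (S v)) * 1ℚ                        ≡⟨ *-identityʳ _ ⟩
      inv (W S) * f (S v)                               ∎

  φ-update : ∀ S v w → φ (update S v w) - φ S ≡ (χ S v - χ S w) * inv (deg G w)
  φ-update S v w = begin
    φ (update S v w) - φ S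
      ≡⟨ ≡.sym (∑-distrib-- V _ _) ⟩
    ∑[ u ∈ V ] (χ (update S v w) u * inv (deg G u) - χ S u * inv (deg G u))
      ≡⟨ ∑-cong V (change (inv ∘ deg G)) ⟩
    ∑[ u ∈ V ] (if does (u ≟ w) then (χ S v - χ S w) * inv (deg G w) else 0ℚ)
      ≡⟨ ∑-indicator w _ ⟩
    (χ S v - χ S w) * inv (deg G w)
      ∎
    where
    open ≡-Reasoning
    factor : ∀ a b i → a * i - b * i ≡ (a - b) * i
    factor = solve-∀ ℚ-ring
    cancel : ∀ a i → a * i - a * i ≡ 0ℚ
    cancel = solve-∀ ℚ-ring
    -- The weight is kept abstract so that `with` need not normalise `inv (deg G u)`.
    change : ∀ (c : Fin n → ℚ) u → χ (update S v w) u * c u - χ S u * c u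
                                   ≡ (if does (u ≟ w) then (χ S v - χ S w) * c w else 0ℚ)
    change c u with u ≟ w
    ... | yes refl = factor (χ S v) (χ S u) (c u)
    ... | no  _    = cancel (χ S u) (c u)

  drift≡∑² : ∀ S → drift S ≡ ∑² (λ v w → edgeRate S v w * (f (S v) * (χ S v - χ S w)))
  drift≡∑² S = ∑-cong V λ v → trans (∑-filterᵇ V (adj G v) _) (∑-cong V (oriented v))
    where
    rearrange : ∀ x iW iv iw a b → x * iW * iv * ((a - b) * iw) ≡ iW * (iv * iw) * (x * (a - b))
    rearrange = solve-∀ ℚ-ring
    oriented : ∀ v w → (if adj G v w then stepProb S v * (φ (update S v w) - φ S) else 0ℚ)
                       ≡ edgeRate S v w * (f (S v) * (χ S v - χ S w))
    oriented v w =
      trans (cong (λ x → if adj G v w then x else 0ℚ)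
                  (trans (cong (stepProb S v *_) (φ-update S v w))
                         (rearrange (f (S v)) (inv (W S)) (inv (deg G v)) (inv (deg G w)) (χ S v) (χ S w))))
            (if-*ʳ (adj G v w) (inv (W S) * (inv (deg G v) * inv (deg G w))) (f (S v) * (χ S v - χ S w)))

  edgeRate-sym : ∀ S v w → edgeRate S v w ≡ edgeRate S w v
  edgeRate-sym S v w = cong₂ (λ b r → if b then r else 0ℚ) (Graph.sym G v w)
                             (cong (inv (W S) *_) (*-comm (inv (deg G v)) (inv (deg G w))))

  -- Each edge is counted once from each end; the two orientations combine into pairDrift.
  drift-doubled : ∀ S → drift S + drift S ≡ ∑² (pairDrift S)
  drift-doubled S = begin
    drift S + drift S
      ≡⟨ cong₂ _+_ (drift≡∑² S) (trans (drift≡∑² S) (∑-comm V V _)) ⟩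
    ∑² (λ v w → a v w * (F v * (χ S v - χ S w))) + ∑² (λ v w → a w v * (F w * (χ S w - χ S v)))
      ≡⟨ cong (∑² (λ v w → a v w * (F v * (χ S v - χ S w))) +_)
              (∑²-cong λ v w → cong (_* (F w * (χ S w - χ S v))) (edgeRate-sym S w v)) ⟩
    ∑² (λ v w → a v w * (F v * (χ S v - χ S w))) + ∑² (λ v w → a v w * (F w * (χ S w - χ S v)))
      ≡⟨ ≡.sym (∑²-distrib-+ _ _) ⟩
    ∑² (λ v w → a v w * (F v * (χ S v - χ S w)) + a v w * (F w * (χ S w - χ S v)))
      ≡⟨ ∑²-cong (λ v w → combine (a v w) (F v) (F w) (χ S v) (χ S w)) ⟩
    ∑² (pairDrift S)
      ∎
    where
    open ≡-Reasoning
    a : Fin n → Fin n → ℚ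
    a = edgeRate S
    F : Fin n → ℚ
    F = f ∘ S
    combine : ∀ r x y s t → r * (x * (s - t)) + r * (y * (t - s)) ≡ r * ((x - y) * (s - t))
    combine = solve-∀ ℚ-ring

  fitnessGap-nonNeg : ∀ {i} j → i ≡ α → 0ℚ ≤ f i - f j
  fitnessGap-nonNeg j refl = p≤q⇒0≤q-p (f≤fα j)

  -- The second factor is nonzero only across the boundary of V_α, where α, being fittest, is ahead.
  gap*χ-gap-nonNeg : ∀ S v w → 0ℚ ≤ (f (S v) - f (S w)) * (χ S v - χ S w)
  gap*χ-gap-nonNeg S v w with S v ≟ α | S w ≟ α
  ... | yes _    | yes _    = ≤-reflexive (≡.sym (*-zeroʳ (f (S v) - f (S w))))
  ... | yes Sv≡α | no  _    = subst (0ℚ ≤_) (≡.sym (*-identityʳ (f (S v) - f (S w)))) (fitnessGap-nonNeg (S w) Sv≡α)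
  ... | no  _    | yes Sw≡α = subst (0ℚ ≤_) (≡.sym (times-minus-1 (f (S v)) (f (S w)))) (fitnessGap-nonNeg (S v) Sw≡α)
    where
    times-minus-1 : ∀ x y → (x - y) * (0ℚ - 1ℚ) ≡ y - x
    times-minus-1 = solve-∀ ℚ-ring
  ... | no  _    | no  _    = ≤-reflexive (≡.sym (*-zeroʳ (f (S v) - f (S w))))

  edgeRate-nonNeg : ∀ S v w → 0ℚ ≤ edgeRate S v w
  edgeRate-nonNeg S v w =
    if-nonNeg (adj G v w) (*-nonNeg (inv-nonNeg (W-nonNeg S)) (*-nonNeg (inv-deg-nonNeg v) (inv-deg-nonNeg w)))

  pairDrift-nonNeg : ∀ S v w → 0ℚ ≤ pairDrift S v w
  pairDrift-nonNeg S v w = *-nonNeg (edgeRate-nonNeg S v w) (gap*χ-gap-nonNeg S v w)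

  pairDrift-sym : ∀ S v w → pairDrift S v w ≡ pairDrift S w v
  pairDrift-sym S v w = cong₂ _*_ (edgeRate-sym S v w) (swap (f (S v)) (f (S w)) (χ S v) (χ S w))
    where
    swap : ∀ x y s t → (x - y) * (s - t) ≡ (y - x) * (t - s)
    swap = solve-∀ ℚ-ring

  pairDrift≤drift : ∀ S {v w} → v ≢ w → pairDrift S v w ≤ drift S
  pairDrift≤drift S {v} {w} v≢w = p+p≤q+q⇒p≤q (begin
    pairDrift S v w + pairDrift S v w      ≡⟨ cong (pairDrift S v w +_) (pairDrift-sym S v w) ⟩
    pairDrift S v w + pairDrift S w v      ≤⟨ +-mono-≤ (term≤∑ (pairDrift-nonNeg S v) w)
                                                        (term≤∑ (pairDrift-nonNeg S w) v) ⟩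
    ∑ V (pairDrift S v) + ∑ V (pairDrift S w) ≤⟨ two-terms≤∑ (λ x → ∑-nonNeg V (pairDrift-nonNeg S x)) v≢w ⟩
    ∑² (pairDrift S)                       ≡⟨ ≡.sym (drift-doubled S) ⟩
    drift S + drift S                      ∎)
    where open ≤-Reasoning

  module Absorption (conn : Connected G) (f* : ℚ) (f≤f* : ∀ j → j ≢ α → f j ≤ f*) (f*<fα : f* < f α) where

    N K Δ C : ℚ
    N = ℕtoℚ n
    K = ℕtoℚ (sucℕ n)
    Δ = f α - f*
    C = f α * inv Δ * ℕtoℚ (n ^ 3)

    B : Config n k → ℚ
    B S = (K - φ S) * C

    minPairDrift : ℚ
    minPairDrift = inv (N * f α) * (inv N * inv N) * Δ

    Δ-pos : 0ℚ < Δ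
    Δ-pos = p<q⇒0<q-p f*<fα

    C-nonNeg : 0ℚ ≤ C
    C-nonNeg = *-nonNeg (*-nonNeg (f-nonNeg α) (inv-nonNeg (<⇒≤ Δ-pos))) (ℕtoℚ-nonNeg (n ^ 3))

    B-nonNeg : ∀ S → 0ℚ ≤ B S
    B-nonNeg S = *-nonNeg (p≤q⇒0≤q-p (≤-trans (φ≤n S) (ℕtoℚ-mono-≤ (ℕₚ.n≤1+n n)))) C-nonNeg

    B≤K*C : ∀ S → B S ≤ f α * inv Δ * ℕtoℚ (sucℕ n *ℕ n ^ 3)
    B≤K*C S = begin
      (K - φ S) * C                       ≤⟨ *-monoʳ-≤-0≤ C-nonNeg (+-monoʳ-≤ K (neg-antimono-≤ (φ-nonNeg S))) ⟩
      (K - 0ℚ) * C                        ≡⟨ regroup K (f α) (inv Δ) (ℕtoℚ (n ^ 3)) ⟩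
      f α * inv Δ * (K * ℕtoℚ (n ^ 3))    ≡⟨ cong (f α * inv Δ *_) (≡.sym (ℕtoℚ-* (sucℕ n) (n ^ 3))) ⟩
      f α * inv Δ * ℕtoℚ (sucℕ n *ℕ n ^ 3) ∎
      where
      open ≤-Reasoning
      regroup : ∀ k x i c → (k - 0ℚ) * (x * i * c) ≡ x * i * (k * c)
      regroup = solve-∀ ℚ-ring

    module _ (1≤N : 1ℚ ≤ N) where

      0<N : 0ℚ < N
      0<N = <-≤-trans 0<1 1≤N

      0<N*fα : 0ℚ < N * f α
      0<N*fα = <-≤-trans 0<1 (*-mono-≤-0≤ 0≤1 0≤1 1≤N (f≥1 α))

      minPairDrift≤pairDrift : ∀ {S b₁ b₂} → adj G b₁ b₂ ≡ true → S b₁ ≡ α → S b₂ ≢ α →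
                               minPairDrift ≤ pairDrift S b₁ b₂
      minPairDrift≤pairDrift {S} {b₁} {b₂} b₁~b₂ Sb₁≡α Sb₂≢α = begin
        inv (N * f α) * (inv N * inv N) * Δ
          ≤⟨ *-mono-≤-0≤ (*-nonNeg (inv-nonNeg (<⇒≤ 0<N*fα)) (*-nonNeg inv-N-nonNeg inv-N-nonNeg)) (<⇒≤ Δ-pos)
                         (*-mono-≤-0≤ (inv-nonNeg (<⇒≤ 0<N*fα)) (*-nonNeg inv-N-nonNeg inv-N-nonNeg)
                                      (inv-antimono-≤ 0<W (W≤n*fα S))
                                      (*-mono-≤-0≤ inv-N-nonNeg inv-N-nonNeg (inv-N≤inv-deg b₁~b₂) (inv-N≤inv-deg b₂~b₁)))
                         (+-monoʳ-≤ (f α) (neg-antimono-≤ (f≤f* (S b₂) Sb₂≢α))) ⟩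
        r * (f α - f (S b₂))
          ≡⟨ ≡.sym (cong (r *_) (*-identityʳ (f α - f (S b₂)))) ⟩
        r * ((f α - f (S b₂)) * (1ℚ - 0ℚ))
          ≡⟨ ≡.sym (cong₂ (λ x y → r * ((f α - f (S b₂)) * (x - y))) (χ-α {S} {b₁} Sb₁≡α) (χ-≢α {S} {b₂} Sb₂≢α)) ⟩
        r * ((f α - f (S b₂)) * (χ S b₁ - χ S b₂))
          ≡⟨ ≡.sym (cong₂ (λ e x → (if e then r else 0ℚ) * ((f x - f (S b₂)) * (χ S b₁ - χ S b₂))) b₁~b₂ Sb₁≡α) ⟩
        pairDrift S b₁ b₂
          ∎
        where
        open ≤-Reasoning
        r : ℚ
        r = inv (W S) * (inv (deg G b₁) * inv (deg G b₂))
        b₂~b₁ : adj G b₂ b₁ ≡ true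
        b₂~b₁ = trans (Graph.sym G b₂ b₁) b₁~b₂
        inv-N-nonNeg : 0ℚ ≤ inv N
        inv-N-nonNeg = inv-nonNeg (<⇒≤ 0<N)
        0<W : 0ℚ < W S
        0<W = <-≤-trans 0<1 (≤-trans (f≥1 (S b₁)) (term≤∑ (f-nonNeg ∘ S) b₁))
        inv-N≤inv-deg : ∀ {v w} → adj G v w ≡ true → inv N ≤ inv (deg G v)
        inv-N≤inv-deg {v} v~w = inv-antimono-≤ (<-≤-trans 0<1 (1≤deg G v~w)) (deg≤n G v)

      C*minPairDrift≡1 : C * minPairDrift ≡ 1ℚ
      C*minPairDrift≡1 = begin
        f α * inv Δ * ℕtoℚ (n ^ 3) * minPairDrift
          ≡⟨ cong (λ c → f α * inv Δ * c * minPairDrift) ℕtoℚ-n³ ⟩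
        f α * inv Δ * (N * (N * (N * 1ℚ))) * (inv (N * f α) * (inv N * inv N) * Δ)
          ≡⟨ regroup (f α) (inv Δ) N (inv (N * f α)) (inv N) Δ ⟩
        (N * f α * inv (N * f α)) * ((N * inv N) * ((N * inv N) * (Δ * inv Δ)))
          ≡⟨ cong₂ (λ x y → x * (y * (y * (Δ * inv Δ)))) (*-inv≡1 0<N*fα) (*-inv≡1 0<N) ⟩
        1ℚ * (1ℚ * (1ℚ * (Δ * inv Δ)))
          ≡⟨ cong (λ x → 1ℚ * (1ℚ * (1ℚ * x))) (*-inv≡1 Δ-pos) ⟩
        1ℚ
          ∎
        where
        open ≡-Reasoning
        ℕtoℚ-n³ : ℕtoℚ (n ^ 3) ≡ N * (N * (N * 1ℚ))
        ℕtoℚ-n³ = trans (ℕtoℚ-* n (n ^ 2)) (cong (N *_) (trans (ℕtoℚ-* n (n ^ 1)) (cong (N *_) (ℕtoℚ-* n 1))))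
        regroup : ∀ x i m j l d → x * i * (m * (m * (m * 1ℚ))) * (j * (l * l) * d)
                                  ≡ (m * x * j) * ((m * l) * ((m * l) * (d * i)))
        regroup = solve-∀ ℚ-ring

    1≤C*drift : ∀ S → absorbed α S ≡ false → 1ℚ ≤ C * drift S
    1≤C*drift S ¬abs =
      let (b₁ , b₂ , b₁~b₂ , Sb₁≡α , Sb₂≢α) = ¬absorbed⇒crossing-edge G conn α S ¬abs
          b₁≢b₂ = λ b₁≡b₂ → Sb₂≢α (subst (λ x → S x ≡ α) b₁≡b₂ Sb₁≡α)
          1≤N   = ≤-trans (1≤deg G b₁~b₂) (deg≤n G b₁)
      in begin
      1ℚ                ≡⟨ ≡.sym (C*minPairDrift≡1 1≤N) ⟩
      C * minPairDrift  ≤⟨ *-monoˡ-≤-0≤ C-nonNeg (≤-trans (minPairDrift≤pairDrift 1≤N b₁~b₂ Sb₁≡α Sb₂≢α)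
                                                          (pairDrift≤drift S b₁≢b₂)) ⟩
      C * drift S       ∎
      where open ≤-Reasoning

    ∑ₑ-stepProb*B : ∀ S → ∑ₑ (λ v w → stepProb S v * B (update S v w))
                          ≡ B S * ∑ₑ (λ v _ → stepProb S v) - C * drift S
    ∑ₑ-stepProb*B S =
      trans (∑ₑ-cong λ v w → expand (stepProb S v) K (φ (update S v w)) (φ S) C)
            (∑ₑ-linear (B S) C (λ v _ → stepProb S v) (λ v w → stepProb S v * (φ (update S v w) - φ S)))
      where
      expand : ∀ p k x y c → p * ((k - x) * c) ≡ (k - y) * c * p - c * (p * (x - y))
      expand = solve-∀ ℚ-ring

    B-supermartingale : ∀ S → absorbed α S ≡ false →
                        1ℚ + ∑ₑ (λ v w → stepProb S v * B (update S v w)) ≤ B S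
    B-supermartingale S ¬abs = begin
      1ℚ + ∑ₑ (λ v w → stepProb S v * B (update S v w))
        ≡⟨ cong (1ℚ +_) (∑ₑ-stepProb*B S) ⟩
      1ℚ + (B S * ∑ₑ (λ v _ → stepProb S v) - C * drift S)
        ≤⟨ +-monoʳ-≤ 1ℚ (+-mono-≤ (*-monoˡ-≤-0≤ (B-nonNeg S) (∑ₑ-stepProb≤1 S))
                                  (neg-antimono-≤ (1≤C*drift S ¬abs))) ⟩
      1ℚ + (B S * 1ℚ - 1ℚ)
        ≡⟨ cancel (B S) ⟩
      B S
        ∎
      where
      open ≤-Reasoning
      cancel : ∀ b → 1ℚ + (b * 1ℚ - 1ℚ) ≡ b
      cancel = solve-∀ ℚ-ring

    -- `if-≤` rather than `with`: abstracting `absorbed α S` would normalise the whole goal.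
    expTrunc≤B : ∀ T S → expTrunc G f α T S ≤ B S
    expTrunc≤B ℕ.zero S = B-nonNeg S
    expTrunc≤B (sucℕ T) S = if-≤ (absorbed α S) (λ _ → B-nonNeg S) λ ¬abs →
      ≤-trans (+-monoʳ-≤ 1ℚ (∑ₑ-mono-≤ λ v w → *-monoˡ-≤-0≤ (stepProb-nonNeg S v) (expTrunc≤B T (update S v w))))
              (B-supermartingale S ¬abs)

corollary14 : (n k : ℕ) (G : Graph n) → Connected G → 1 <ℕ k →
    (f : Fin k → ℚ) → (∀ i → 1ℚ ≤ f i) →
    (α : Fin k) → (∀ j → f j ≤ f α) →
    (fstar : ℚ) → (∃ λ j → j ≢ α × f j ≡ fstar) → (∀ j → j ≢ α → f j ≤ fstar) →
    fstar < f α →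
    (M₀ : Config n k) → (∀ j → ∃ λ v → M₀ v ≡ j) →
    ∀ T → expTrunc G f α T M₀
            ≤ f α * inv (f α - fstar) * ℕtoℚ (sucℕ n *ℕ n ^ 3)
corollary14 n k G conn _ f f≥1 α f≤fα f* _ f≤f* f*<fα M₀ _ T =
  ≤-trans (expTrunc≤B T M₀) (B≤K*C M₀)
  where open Potential.Absorption G f α f≥1 f≤fα conn f* f≤f* f*<fα
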